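{- Let $k$ be a positive integer. There is no $2k$-ordered bracelet graph with more than $6$ parts that has minimum degree $2k-1$ and maximum degree less than $2k+2$.
   Context: All graphs are finite and simple. A graph $G$ is a bracelet graph if its vertex set can be partitioned into nonempty sets $V_1, \ldots, V_m$ with $m\geq 3$ (called the parts) such that two vertices $u\in V_i$ and $v\in V_j$ are adjacent if and only if $i-j\equiv 1$ or $-1 \pmod m$. A simple graph $G$ is $r$-ordered if, for every sequence $v_1, \ldots, v_r$ of $r$ distinct vertices of $G$, there exists a cycle in $G$ containing $v_1, \ldots, v_r$ in this (cyclic) order. -}

module Defs where

open import Data.Nat using (ℕ; zero; suc; _+_; _*_; _∸_; _≤_; _<_; NonZero)
open import Data.Nat.DivMod using (_%_)
open import Data.Fin using (Fin; toℕ)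
open import Data.Bool using (Bool; true; false)
open import Data.List using (List; length; filterᵇ; allFin)
open import Data.Product using (Σ; ∃; ∃-syntax; _×_; _,_)
open import Data.Sum using (_⊎_)
open import Data.Empty using (⊥)
open import Relation.Binary.PropositionalEquality using (_≡_)
open import Relation.Nullary using (¬_)
open import Function.Definitions using (Injective; Surjective)

record Graph (n : ℕ) : Set where
  field
    adj   : Fin n → Fin n → Bool
    sym   : ∀ u v → adj u v ≡ adj v u
    irrefl : ∀ v → adj v v ≡ false
open Graph public

Adj : ∀ {n} → Graph n → Fin n → Fin n → Set
Adj G u v = adj G u v ≡ true

degree : ∀ {n} → Graph n → Fin n → ℕ
degree {n} G u = length (filterᵇ (adj G u) (allFin n))

MinDegreeIs : ∀ {n} → Graph n → ℕ → Set
MinDegreeIs {n} G d = (∃[ v ] degree G v ≡ d) × (∀ v → d ≤ degree G v)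

MaxDegreeLessThan : ∀ {n} → Graph n → ℕ → Set
MaxDegreeLessThan {n} G d = ∀ v → degree G v < d

CycSucc : ∀ {m} → Fin m → Fin m → Set
CycSucc {zero} i j = ⊥
CycSucc {suc m} i j = toℕ i ≡ (toℕ j + 1) % suc m

CycAdjacent : ∀ {m} → Fin m → Fin m → Set
CycAdjacent i j = CycSucc i j ⊎ CycSucc j i

-- G is a bracelet graph with parts V_0,…,V_{m-1} given by  part : Fin n → Fin m
-- (each part nonempty = part is surjective), m ≥ 3.
IsBraceletPartition : ∀ {n} → Graph n → (m : ℕ) → (Fin n → Fin m) → Set
IsBraceletPartition {n} G m part =
  3 ≤ m × Surjective _≡_ _≡_ part
  × (∀ u v → (Adj G u v → CycAdjacent (part u) (part v))
           × (CycAdjacent (part u) (part v) → Adj G u v))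

IsBraceletWithParts : ∀ {n} → Graph n → ℕ → Set
IsBraceletWithParts {n} G m = Σ (Fin n → Fin m) (IsBraceletPartition G m)

record Cycle {n} (G : Graph n) : Set where
  field
    len       : ℕ
    len≥3     : 3 ≤ len
    vert      : Fin len → Fin n
    distinct  : Injective _≡_ _≡_ vert
    edges     : ∀ (i j : Fin len) → CycSucc j i → Adj G (vert i) (vert j)
open Cycle public

-- the cycle C contains v_1,…,v_r in this cyclic order: after choosing a starting
-- point and direction (both absorbed in the choice of the cycle's listing),
-- the v_i appear at strictly increasing positions.
ContainsInOrder : ∀ {n r} {G : Graph n} → Cycle G → (Fin r → Fin n) → Set
ContainsInOrder {n} {r} C v =
  Σ (Fin r → Fin (len C)) λ p →
    (∀ (i j : Fin r) → toℕ i < toℕ j → toℕ (p i) < toℕ (p j))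
    × (∀ i → vert C (p i) ≡ v i)

Ordered : ∀ {n} → ℕ → Graph n → Set
Ordered {n} r G =
  ∀ (v : Fin r → Fin n) → Injective _≡_ _≡_ v →
    Σ (Cycle G) λ C → ContainsInOrder C v

-- A vertex in part V_c has degree a_(c-1) + a_(c+1), where a_c = |V_c|, so these sums lie
-- between 2k - 1 and 2k + 1.  Rotating and reflecting the parts puts a vertex of minimum degree
-- into V_2 with a_1 < k; then a_1 + a_3 = 2k - 1.
--   Separator bound: if V_j and V_l cut the bracelet into two arcs and V_x, V_y lie on different
-- arcs with at least k vertices each, take x_1, …, x_k ∈ V_x and y_1, …, y_k ∈ V_y.  A cycle
-- through x_1, y_1, …, x_k, y_k in this order changes arcs 2k times, each time through V_j ∪ V_l,
-- so a_j + a_l ≥ 2k.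
--   If a_2 ≥ k, then a_4 ≥ k or a_6 ≥ k, and the separator {V_1, V_3} contradicts a_1 + a_3 < 2k.
-- If a_2 < k, then a_0, a_3, a_4 ≥ k; if a_4 ≤ k the separator {V_1, V_4} (x = 3, y = 0) has
-- fewer than 2k vertices, and otherwise a_6 ≤ k and {V_2, V_6} (x = 4, y = 0) does.  With at
-- least seven parts, V_0, …, V_6 are distinct.
module Submission where

open import Defs hiding (sym)
open import Data.Nat using (ℕ; _+_; _*_; _∸_; _≤_; _<_)
open import Relation.Nullary using (¬_)
open import Data.Product using (∃-syntax; _×_)

open import Level using (Level)
open import Data.Nat using (zero; suc; z≤n; s≤s; _≟_; _≤?_; _<?_)
open import Data.Nat.Properties
open import Data.Nat.DivMod using (_%_; m≤n⇒m%n≡m; n%n≡0)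
open import Data.Nat.Tactic.RingSolver using (solve-∀)
open import Data.Fin as Fin
  using (Fin; zero; suc; toℕ; fromℕ; fromℕ<; inject₁; inject≤; cast; remQuot; combine)
open import Data.Fin.Properties as Finₚ
  using ( toℕ-injective; toℕ-inject₁; toℕ-fromℕ; toℕ-fromℕ<; toℕ≤pred[n]; ≤fromℕ; ≤̄⇒inject₁<
        ; injective⇒≤; inject≤-injective; toℕ-cast; combine-remQuot; toℕ-combine)
open import Data.Bool using (Bool; true; false; T)
open import Data.Bool.Properties using (T-≡)
open import Data.List using (List; []; _∷_; length; filter; allFin; lookup)
open import Data.List.Properties using (filter-≐)
open import Data.List.Membership.Propositional using (_∈_)
open import Data.List.Membership.Propositional.Properties
  using (∈-filter⁺; ∈-filter⁻; ∈-allFin; ∈-lookup)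
open import Data.List.Membership.Setoid.Properties using (index-injective)
import Data.List.Relation.Unary.All as All
open import Data.List.Relation.Unary.AllPairs using (_∷_)
open import Data.List.Relation.Unary.Unique.Propositional using (Unique)
open import Data.List.Relation.Unary.Unique.Propositional.Properties using (allFin⁺; filter⁺)
open import Data.Product using (Σ; _,_; proj₁; proj₂; uncurry)
open import Data.Sum using (_⊎_; inj₁; inj₂; [_,_]′) renaming (map to ⊎-map; swap to ⊎-swap)
open import Data.Empty using (⊥; ⊥-elim)
open import Function using (id; _∘_; _⇔_; mk⇔; Equivalence)
open import Function.Definitions using (Injective)
open import Function.Properties.Equivalence using () renaming (refl to ⇔-refl; trans to ⇔-trans)
open import Relation.Binary using (tri<; tri≈; tri>)
open import Relation.Binary.PropositionalEquality
open import Relation.Nullary using (Dec; yes; no; does; _×-dec_)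
open import Relation.Nullary.Decidable using (T?; does-⇔; dec-true; dec-false)
open import Relation.Unary using (Pred; Decidable)
open import Relation.Unary.Properties using (_∪?_)

open Equivalence using (to; from)

private
  variable
    a b ℓ ℓ′ : Level
    A : Set a
    B : Set b
    n k : ℕ


-- Counting

lookup-injective : ∀ {xs : List A} → Unique xs → Injective _≡_ _≡_ (lookup xs)
lookup-injective (_ ∷ _) {zero} {zero} _ = refl
lookup-injective (x∉xs ∷ _) {zero} {suc j} eq = ⊥-elim (All.lookup x∉xs (∈-lookup j) eq)
lookup-injective (x∉xs ∷ _) {suc i} {zero} eq = ⊥-elim (All.lookup x∉xs (∈-lookup i) (sym eq))
lookup-injective (_ ∷ u) {suc i} {suc j} eq = cong suc (lookup-injective u eq)

count : {P : Pred (Fin n) ℓ} → Decidable P → ℕ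
count {n} P? = length (filter P? (allFin n))

module _ {P : Pred A ℓ} {Q : Pred A ℓ′} (P? : Decidable P) (Q? : Decidable Q) where

  length-filter-∪ : (∀ {x} → P x → Q x → ⊥) → ∀ xs →
    length (filter (P? ∪? Q?) xs) ≡ length (filter P? xs) + length (filter Q? xs)
  length-filter-∪ disjoint [] = refl
  length-filter-∪ disjoint (x ∷ xs) with P? x | Q? x
  ... | yes px | yes qx = ⊥-elim (disjoint px qx)
  ... | yes _  | no _  = cong suc (length-filter-∪ disjoint xs)
  ... | no _  | yes _  = trans (cong suc (length-filter-∪ disjoint xs)) (sym (+-suc _ _))
  ... | no _  | no _   = length-filter-∪ disjoint xs

module _ {P : Pred (Fin n) ℓ} (P? : Decidable P) where

  count-cong : {Q : Pred (Fin n) ℓ′} (Q? : Decidable Q) → (∀ w → P w ⇔ Q w) →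
    count P? ≡ count Q?
  count-cong Q? P⇔Q =
    cong length (filter-≐ P? Q? ((λ {w} → to (P⇔Q w)) , (λ {w} → from (P⇔Q w))) (allFin n))

  count-∪ : {Q : Pred (Fin n) ℓ′} (Q? : Decidable Q) → (∀ {x} → P x → Q x → ⊥) →
    count (P? ∪? Q?) ≡ count P? + count Q?
  count-∪ Q? disjoint = length-filter-∪ P? Q? disjoint (allFin n)

  injective⇒≤-count : (f : Fin k → Fin n) → Injective _≡_ _≡_ f → (∀ i → P (f i)) →
    k ≤ count P?
  injective⇒≤-count f f-inj Pf =
    injective⇒≤ (f-inj ∘ index-injective (setoid _) (member _) (member _))
    where
    member : ∀ i → f i ∈ filter P? (allFin n)
    member i = ∈-filter⁺ P? (∈-allFin (f i)) (Pf i)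

  select : k ≤ count P? → Σ (Fin k → Fin n) λ f → Injective _≡_ _≡_ f × (∀ i → P (f i))
  select k≤ = f , f-injective , f∈P
    where
    xs = filter P? (allFin n)
    f : Fin _ → Fin n
    f i = lookup xs (inject≤ i k≤)
    f-injective : Injective _≡_ _≡_ f
    f-injective = inject≤-injective k≤ k≤ _ _ ∘ lookup-injective (filter⁺ P? (allFin⁺ n))
    f∈P : ∀ i → P (f i)
    f∈P i = proj₂ (∈-filter⁻ P? {xs = allFin n} (∈-lookup (inject≤ i k≤)))


-- Part labels and the automorphisms of the cycle

CycStep : ℕ → ℕ → ℕ → Set
CycStep M x y = suc x ≡ y ⊎ (x ≡ M × y ≡ 0)

CycAdj : ℕ → ℕ → ℕ → Set
CycAdj M x y = CycStep M x y ⊎ CycStep M y x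

i<M⇒[i+1]%[1+M]≡1+i : ∀ {M i} → i < M → (i + 1) % suc M ≡ suc i
i<M⇒[i+1]%[1+M]≡1+i {M} {i} i<M = trans (cong (_% suc M) (+-comm i 1)) (m≤n⇒m%n≡m i<M)

i≡M⇒[i+1]%[1+M]≡0 : ∀ {M i} → i ≡ M → (i + 1) % suc M ≡ 0
i≡M⇒[i+1]%[1+M]≡0 {M} refl = trans (cong (_% suc M) (+-comm M 1)) (n%n≡0 (suc M))

CycSucc⇔CycStep : ∀ {M} (i j : Fin (suc M)) → CycSucc j i ⇔ CycStep M (toℕ i) (toℕ j)
CycSucc⇔CycStep {M} i j = mk⇔ forth back
  where
  forth : CycSucc j i → CycStep M (toℕ i) (toℕ j)
  forth j≡i+1 with m≤n⇒m<n∨m≡n (toℕ≤pred[n] i)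
  ... | inj₁ i<M = inj₁ (sym (trans j≡i+1 (i<M⇒[i+1]%[1+M]≡1+i i<M)))
  ... | inj₂ i≡M = inj₂ (i≡M , trans j≡i+1 (i≡M⇒[i+1]%[1+M]≡0 i≡M))
  back : CycStep M (toℕ i) (toℕ j) → CycSucc j i
  back (inj₁ i+1≡j) = sym (trans (i<M⇒[i+1]%[1+M]≡1+i i<M) i+1≡j)
    where i<M = subst (_≤ M) (sym i+1≡j) (toℕ≤pred[n] j)
  back (inj₂ (i≡M , j≡0)) = trans j≡0 (sym (i≡M⇒[i+1]%[1+M]≡0 i≡M))

CycAdjacent⇔CycAdj : ∀ {M} (i j : Fin (suc M)) → CycAdjacent i j ⇔ CycAdj M (toℕ i) (toℕ j)
CycAdjacent⇔CycAdj i j = mk⇔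
  (⊎-swap ∘ ⊎-map (to (CycSucc⇔CycStep j i)) (to (CycSucc⇔CycStep i j)))
  (⊎-map (from (CycSucc⇔CycStep j i)) (from (CycSucc⇔CycStep i j)) ∘ ⊎-swap)

record CycleAut (M : ℕ) : Set where
  field
    act           : ℕ → ℕ
    act-≤         : ∀ {x} → x ≤ M → act x ≤ M
    act-injective : ∀ {x y} → x ≤ M → y ≤ M → act x ≡ act y → x ≡ y
    act-onto      : ∀ {c} → c ≤ M → ∃[ x ] x ≤ M × act x ≡ c
    act-adj       : ∀ {x y} → x ≤ M → y ≤ M → CycAdj M x y ⇔ CycAdj M (act x) (act y)
open CycleAut

idᵃ : ∀ {M} → CycleAut M
idᵃ = record
  { act = id ; act-≤ = id ; act-injective = λ _ _ → id
  ; act-onto = λ {c} c≤M → c , c≤M , refl ; act-adj = λ _ _ → ⇔-refl }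

_∘ᵃ_ : ∀ {M} → CycleAut M → CycleAut M → CycleAut M
σ ∘ᵃ τ = record
  { act = act σ ∘ act τ
  ; act-≤ = act-≤ σ ∘ act-≤ τ
  ; act-injective = λ x≤ y≤ →
      act-injective τ x≤ y≤ ∘ act-injective σ (act-≤ τ x≤) (act-≤ τ y≤)
  ; act-onto = onto
  ; act-adj = λ x≤ y≤ → ⇔-trans (act-adj τ x≤ y≤) (act-adj σ (act-≤ τ x≤) (act-≤ τ y≤))
  }
  where
  onto : ∀ {c} → c ≤ _ → ∃[ x ] x ≤ _ × act σ (act τ x) ≡ c
  onto c≤ with act-onto σ c≤
  ... | y , y≤ , σy≡c with act-onto τ y≤
  ...   | x , x≤ , τx≡y = x , x≤ , trans (cong (act σ) τx≡y) σy≡c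

cycPred : ℕ → ℕ → ℕ
cycPred M zero    = M
cycPred M (suc x) = x

cycPred-step : ∀ {M x y} → CycStep M x y → CycStep M (cycPred M x) (cycPred M y)
cycPred-step {x = zero}  (inj₁ refl)          = inj₂ (refl , refl)
cycPred-step {x = suc x} (inj₁ refl)          = inj₁ refl
cycPred-step {M = zero}  (inj₂ (refl , refl)) = inj₂ (refl , refl)
cycPred-step {M = suc M} (inj₂ (refl , refl)) = inj₁ refl

cycPred-step⁻ : ∀ {M x y} → x ≤ M → y ≤ M →
  CycStep M (cycPred M x) (cycPred M y) → CycStep M x y
cycPred-step⁻ {x = zero}  {zero}  _   _   (inj₁ 1+M≡M)     = ⊥-elim (1+n≢n 1+M≡M)
cycPred-step⁻ {x = zero}  {zero}  _   _   (inj₂ (_ , M≡0)) = inj₂ (sym M≡0 , refl)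
cycPred-step⁻ {x = zero}  {suc y} _   y<M (inj₁ refl)      = ⊥-elim (1+n≰n (≤-trans (n≤1+n _) y<M))
cycPred-step⁻ {x = zero}  {suc y} _   _   (inj₂ (_ , refl)) = inj₁ refl
cycPred-step⁻ {x = suc x} {zero}  _   _   (inj₁ 1+x≡M)     = inj₂ (1+x≡M , refl)
cycPred-step⁻ {x = suc x} {zero}  x<M _   (inj₂ (refl , _)) = ⊥-elim (1+n≰n x<M)
cycPred-step⁻ {x = suc x} {suc y} _   _   (inj₁ refl)      = inj₁ refl
cycPred-step⁻ {x = suc x} {suc y} x<M _   (inj₂ (refl , _)) = ⊥-elim (1+n≰n x<M)

rotation₁ : ∀ {M} → CycleAut M
rotation₁ {M} = record
  { act = cycPred M
  ; act-≤ = λ { {zero} _ → ≤-refl ; {suc x} x<M → <⇒≤ x<M }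
  ; act-injective = injective
  ; act-onto = onto
  ; act-adj = λ x≤ y≤ → mk⇔ (⊎-map cycPred-step cycPred-step)
                             (⊎-map (cycPred-step⁻ x≤ y≤) (cycPred-step⁻ y≤ x≤))
  }
  where
  injective : ∀ {x y} → x ≤ M → y ≤ M → cycPred M x ≡ cycPred M y → x ≡ y
  injective {zero}  {zero}  _   _   _    = refl
  injective {zero}  {suc y} _   y<M refl = ⊥-elim (1+n≰n y<M)
  injective {suc x} {zero}  x<M _   refl = ⊥-elim (1+n≰n x<M)
  injective {suc x} {suc y} _   _   x≡y  = cong suc x≡y
  onto : ∀ {c} → c ≤ M → ∃[ x ] x ≤ M × cycPred M x ≡ c
  onto c≤M with m≤n⇒m<n∨m≡n c≤M
  ... | inj₁ c<M = suc _ , c<M , refl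
  ... | inj₂ c≡M = zero , z≤n , sym c≡M

reflection-step : ∀ {M x y} → y ≤ M → CycStep M x y → CycStep M (M ∸ y) (M ∸ x)
reflection-step {M} y≤M (inj₁ refl)          = inj₁ (sym (+-∸-assoc 1 y≤M))
reflection-step {M} _   (inj₂ (refl , refl)) = inj₂ (refl , n∸n≡0 M)

reflection : ∀ {M} → CycleAut M
reflection {M} = record
  { act = M ∸_
  ; act-≤ = λ {x} _ → m∸n≤m M x
  ; act-injective = λ x≤ y≤ eq →
      trans (sym (m∸[m∸n]≡n x≤)) (trans (cong (M ∸_) eq) (m∸[m∸n]≡n y≤))
  ; act-onto = λ {c} c≤ → M ∸ c , m∸n≤m M c , m∸[m∸n]≡n c≤
  ; act-adj = λ x≤ y≤ → mk⇔ (mirror x≤ y≤) (back x≤ y≤)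
  }
  where
  mirror : ∀ {x y} → x ≤ M → y ≤ M → CycAdj M x y → CycAdj M (M ∸ x) (M ∸ y)
  mirror x≤ y≤ (inj₁ step) = inj₂ (reflection-step y≤ step)
  mirror x≤ y≤ (inj₂ step) = inj₁ (reflection-step x≤ step)
  back : ∀ {x y} → x ≤ M → y ≤ M → CycAdj M (M ∸ x) (M ∸ y) → CycAdj M x y
  back {x} {y} x≤ y≤ adj = subst₂ (CycAdj M) (m∸[m∸n]≡n x≤) (m∸[m∸n]≡n y≤)
                             (mirror (m∸n≤m M x) (m∸n≤m M y) adj)

rotation : ∀ {M} → ℕ → CycleAut M
rotation zero    = idᵃ
rotation (suc d) = rotation d ∘ᵃ rotation₁

rotation-shifts : ∀ {M} d c → act (rotation {M} d) (c + d) ≡ c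
rotation-shifts zero    c = +-identityʳ c
rotation-shifts (suc d) c rewrite +-suc c d = rotation-shifts d c

-- The reflection x ↦ (3 + M) ∸ x sends 0 and 1 to 2 + (1 + M) and 2 + M.
moving-to-2 : ∀ {M} c → Σ (CycleAut (3 + M)) λ σ → act σ c ≡ 2
moving-to-2 {M} zero          = rotation (1 + M) ∘ᵃ reflection , rotation-shifts (1 + M) 2
moving-to-2 {M} (suc zero)    = rotation M ∘ᵃ reflection , rotation-shifts M 2
moving-to-2 {M} (suc (suc c)) = rotation c , rotation-shifts c 2

reflection-fixing-2 : ∀ {M} → Σ (CycleAut (4 + M)) λ σ → act σ 2 ≡ 2 × act σ 3 ≡ 1
reflection-fixing-2 {M} = rotation M ∘ᵃ reflection , rotation-shifts M 2 , rotation-shifts M 1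


-- Bracelet labellings

record BraceletLabelling {n} (G : Graph n) (M : ℕ) : Set where
  field
    label      : Fin n → ℕ
    label-≤    : ∀ w → label w ≤ M
    adj⇔       : ∀ u w → Adj G u w ⇔ CycAdj M (label u) (label w)
    label-onto : ∀ {c} → c ≤ M → ∃[ w ] label w ≡ c
open BraceletLabelling

module _ {n} {G : Graph n} where

  bracelet-labelling : ∀ {M part} → IsBraceletPartition G (suc M) part → BraceletLabelling G M
  bracelet-labelling {M} {part} (_ , part-onto , adjacency) = record
    { label      = toℕ ∘ part
    ; label-≤    = toℕ≤pred[n] ∘ part
    ; adj⇔       = λ u w → ⇔-trans (mk⇔ (proj₁ (adjacency u w)) (proj₂ (adjacency u w)))
                                   (CycAdjacent⇔CycAdj (part u) (part w))
    ; label-onto = onto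
    }
    where
    onto : ∀ {c} → c ≤ M → ∃[ w ] toℕ (part w) ≡ c
    onto c≤M with part-onto (fromℕ< (s≤s c≤M))
    ... | w , part-w = w , trans (cong toℕ (part-w refl)) (toℕ-fromℕ< (s≤s c≤M))

  relabel : ∀ {M} → BraceletLabelling G M → CycleAut M → BraceletLabelling G M
  relabel F σ = record
    { label      = act σ ∘ label F
    ; label-≤    = act-≤ σ ∘ label-≤ F
    ; adj⇔       = λ u w → ⇔-trans (adj⇔ F u w) (act-adj σ (label-≤ F u) (label-≤ F w))
    ; label-onto = onto
    }
    where
    onto : ∀ {c} → c ≤ _ → ∃[ w ] act σ (label F w) ≡ c
    onto c≤ with act-onto σ c≤
    ... | x , x≤ , σx≡c with label-onto F x≤
    ...   | w , w↦x = w , trans (cong (act σ) w↦x) σx≡c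

  size : ∀ {M} → BraceletLabelling G M → ℕ → ℕ
  size F c = count (λ w → label F w ≟ c)

  size-relabel : ∀ {M c} (F : BraceletLabelling G M) (σ : CycleAut M) → c ≤ M →
    size (relabel F σ) (act σ c) ≡ size F c
  size-relabel F σ c≤ = count-cong (λ w → label (relabel F σ) w ≟ _) (λ w → label F w ≟ _)
    (λ w → mk⇔ (act-injective σ (label-≤ F w) c≤) (cong (act σ)))

inner-neighbours : ∀ {M x c y} → x ≡ suc c → suc c < M →
  CycAdj M x y ⇔ (y ≡ c ⊎ y ≡ suc (suc c))
inner-neighbours {M} {c = c} {y} refl c+1<M = mk⇔ forth back
  where
  forth : CycAdj M (suc c) y → y ≡ c ⊎ y ≡ suc (suc c)
  forth (inj₁ (inj₁ refl))       = inj₂ refl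
  forth (inj₁ (inj₂ (refl , _))) = ⊥-elim (<-irrefl refl c+1<M)
  forth (inj₂ (inj₁ 1+y≡1+c))    = inj₁ (suc-injective 1+y≡1+c)
  forth (inj₂ (inj₂ (_ , ())))
  back : y ≡ c ⊎ y ≡ suc (suc c) → CycAdj M (suc c) y
  back (inj₁ refl) = inj₂ (inj₁ refl)
  back (inj₂ refl) = inj₁ (inj₁ refl)

module _ {n} {G : Graph n} {M} (F : BraceletLabelling G M) where

  degree-by-sizes : ∀ {u c} → label F u ≡ suc c → suc c < M →
    degree G u ≡ size F c + size F (suc (suc c))
  degree-by-sizes {u} {c} u↦c+1 c+1<M = begin
    degree G u
      ≡⟨⟩
    count (λ w → T? (adj G u w))
      ≡⟨ count-cong (λ w → T? (adj G u w)) neighbour? neighbours ⟩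
    count neighbour?
      ≡⟨ count-∪ (λ w → label F w ≟ c) (λ w → label F w ≟ suc (suc c))
           (λ w↦c w↦c+2 → <⇒≢ (m<n⇒m<1+n (n<1+n c)) (trans (sym w↦c) w↦c+2)) ⟩
    size F c + size F (suc (suc c)) ∎
    where
    open ≡-Reasoning
    neighbour? = (λ w → label F w ≟ c) ∪? (λ w → label F w ≟ suc (suc c))
    neighbours : ∀ w → T (adj G u w) ⇔ (label F w ≡ c ⊎ label F w ≡ suc (suc c))
    neighbours w = ⇔-trans T-≡ (⇔-trans (adj⇔ F u w) (inner-neighbours u↦c+1 c+1<M))


-- Separators

CyclicallyAlternating : ∀ {r} → (Fin (suc r) → A) → Set _
CyclicallyAlternating {r = r} f = (∀ i → f (inject₁ i) ≢ f (suc i)) × f (fromℕ r) ≢ f zero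

alternating-resp : ∀ {r} {f g : Fin (suc r) → A} →
  (∀ i → f i ≡ g i) → CyclicallyAlternating f → CyclicallyAlternating g
alternating-resp f≗g (consecutive , wrap) =
  (λ i → consecutive i ∘ transport) , wrap ∘ transport
  where transport = λ {i j} eq → trans (f≗g i) (trans eq (sym (f≗g j)))

module _ {n ℓ} {G : Graph n} {Cut : Pred (Fin n) ℓ} (cut? : Decidable Cut) (side : Fin n → Bool)
  (side-stable : ∀ {u w} → Adj G u w → ¬ Cut u → ¬ Cut w → side u ≡ side w) where

  module ClosedWalk {L} (vt : Fin (suc L) → Fin n) (vt-injective : Injective _≡_ _≡_ vt)
    (vt-adj : ∀ i j → CycStep L (toℕ i) (toℕ j) → Adj G (vt i) (vt j)) where

    CutIn : (Fin (suc L) → Set) → Set ℓ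
    CutIn Arc = ∃[ q ] Arc q × Cut (vt q)

    CutOrSameSide : Fin (suc L) → Fin (suc L) → Set ℓ
    CutOrSameSide a b =
      CutIn (λ q → a Fin.< q × q Fin.≤ b) ⊎ (side (vt a) ≡ side (vt b) × ¬ Cut (vt b))

    walk : ∀ d {a b} → toℕ b ≡ d + toℕ a → ¬ Cut (vt a) → CutOrSameSide a b
    walk zero {a} {b} b≡a ¬cut-a with toℕ-injective b≡a
    ... | refl = inj₂ (refl , ¬cut-a)
    walk (suc d) {a} {suc b} b≡d+a ¬cut-a
      with walk d {a} {inject₁ b} (trans (toℕ-inject₁ b) (suc-injective b≡d+a)) ¬cut-a
    ... | inj₁ (q , (a<q , q≤b) , cut-q) =
      inj₁ (q , (a<q , m≤n⇒m≤1+n (≤-trans q≤b (≤-reflexive (toℕ-inject₁ b)))) , cut-q)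
    ... | inj₂ (same , ¬cut-b) with cut? (vt (suc b))
    ...   | yes cut = inj₁ (suc b , (a<b+1 , ≤-refl) , cut)
      where a<b+1 = subst (toℕ a <_) (sym b≡d+a) (s≤s (m≤n+m (toℕ a) d))
    ...   | no ¬cut = inj₂ (trans same (side-stable b~b+1 ¬cut-b ¬cut) , ¬cut)
      where b~b+1 = vt-adj (inject₁ b) (suc b) (inj₁ (cong suc (toℕ-inject₁ b)))

    walk-≤ : ∀ {a b} → a Fin.≤ b → ¬ Cut (vt a) → CutOrSameSide a b
    walk-≤ {a} {b} a≤b = walk (toℕ b ∸ toℕ a) (sym (m∸n+n≡m a≤b))

    module Marks {r} (p : Fin (suc r) → Fin (suc L)) (p-mono : ∀ i j → i Fin.< j → p i Fin.< p j)
      (p-uncut : ∀ i → ¬ Cut (vt (p i))) (alternating : CyclicallyAlternating (side ∘ vt ∘ p)) where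

      p-mono-≤ : ∀ {i j} → i Fin.≤ j → p i Fin.≤ p j
      p-mono-≤ {i} {j} i≤j with m≤n⇒m<n∨m≡n i≤j
      ... | inj₁ i<j = <⇒≤ (p-mono _ _ i<j)
      ... | inj₂ i≡j = ≤-reflexive (cong (toℕ ∘ p) (toℕ-injective i≡j))

      Arc : Fin (suc r) → Fin (suc L) → Set
      Arc zero    q = q Fin.≤ p zero ⊎ p (fromℕ r) Fin.< q
      Arc (suc i) q = p (inject₁ i) Fin.< q × q Fin.≤ p (suc i)

      arc-cut : ∀ i → CutIn (Arc i)
      arc-cut (suc i) with walk-≤ (<⇒≤ (p-mono _ _ (≤̄⇒inject₁< ≤-refl))) (p-uncut (inject₁ i))
      ... | inj₁ found = found
      ... | inj₂ (same , _) = ⊥-elim (proj₁ alternating i same)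
      arc-cut zero with walk-≤ (≤fromℕ (p (fromℕ r))) (p-uncut (fromℕ r))
      ... | inj₁ (q , (last<q , _) , cut) = q , inj₂ last<q , cut
      ... | inj₂ (same-to-end , ¬cut-end) with cut? (vt zero)
      ...   | yes cut = zero , inj₁ z≤n , cut
      ...   | no ¬cut-0 with walk-≤ {zero} {p zero} z≤n ¬cut-0
      ...     | inj₁ (q , (_ , q≤p₀) , cut) = q , inj₁ q≤p₀ , cut
      ...     | inj₂ (same-from-start , _) =
        ⊥-elim (proj₂ alternating
          (trans same-to-end (trans (side-stable end~0 ¬cut-end ¬cut-0) same-from-start)))
        where end~0 = vt-adj (fromℕ L) zero (inj₂ (toℕ-fromℕ L , refl))

      arcs-ordered : ∀ {i j q q′} → i Fin.< j → Arc (suc i) q → Arc (suc j) q′ → q Fin.< q′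
      arcs-ordered {i} {j} i<j (_ , q≤) (after , _) =
        ≤-<-trans q≤ (≤-<-trans (p-mono-≤ i+1≤j) after)
        where i+1≤j = subst (suc (toℕ i) ≤_) (sym (toℕ-inject₁ j)) i<j

      wrap-arc-disjoint : ∀ {j q} → Arc zero q → Arc (suc j) q → ⊥
      wrap-arc-disjoint (inj₁ q≤p₀) (after , _) =
        <-irrefl refl (≤-<-trans q≤p₀ (≤-<-trans (p-mono-≤ z≤n) after))
      wrap-arc-disjoint {j} (inj₂ last<q) (_ , q≤) =
        <-irrefl refl (≤-<-trans q≤ (≤-<-trans (p-mono-≤ (≤fromℕ (suc j))) last<q))

      arcs-disjoint : ∀ {i j q} → Arc i q → Arc j q → i ≡ j
      arcs-disjoint {zero}  {zero}  _ _ = refl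
      arcs-disjoint {zero}  {suc j} a b = ⊥-elim (wrap-arc-disjoint a b)
      arcs-disjoint {suc i} {zero}  a b = ⊥-elim (wrap-arc-disjoint b a)
      arcs-disjoint {suc i} {suc j} a b with Finₚ.<-cmp i j
      ... | tri< i<j _ _ = ⊥-elim (<-irrefl refl (arcs-ordered i<j a b))
      ... | tri≈ _ refl _ = refl
      ... | tri> _ _ j<i = ⊥-elim (<-irrefl refl (arcs-ordered j<i b a))

      marks≤cut-size : suc r ≤ count cut?
      marks≤cut-size =
        injective⇒≤-count cut? (vt ∘ proj₁ ∘ arc-cut) cut-vertex-injective (proj₂ ∘ proj₂ ∘ arc-cut)
        where
        cut-vertex-injective : ∀ {i j} → vt (proj₁ (arc-cut i)) ≡ vt (proj₁ (arc-cut j)) → i ≡ j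
        cut-vertex-injective {i} {j} eq = arcs-disjoint (proj₁ (proj₂ (arc-cut i)))
          (subst (Arc j) (sym (vt-injective eq)) (proj₁ (proj₂ (arc-cut j))))

  alternations≤cut-size : ∀ {r} {s : Fin (suc r) → Fin n} (C : Cycle G) → ContainsInOrder C s →
    (∀ i → ¬ Cut (s i)) → CyclicallyAlternating (side ∘ s) → suc r ≤ count cut?
  alternations≤cut-size record { len = zero ; len≥3 = () }
  alternations≤cut-size record { len = suc L ; vert = vt ; distinct = vt-injective ; edges = edges }
                        (p , p-mono , p↦s) uncut alternating =
    ClosedWalk.Marks.marks≤cut-size vt vt-injective vt-adj p p-mono
      (λ i → subst (¬_ ∘ Cut) (sym (p↦s i)) (uncut i))
      (alternating-resp (λ i → cong side (sym (p↦s i))) alternating)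
    where
    vt-adj : ∀ i j → CycStep L (toℕ i) (toℕ j) → Adj G (vt i) (vt j)
    vt-adj i j = edges i j ∘ from (CycSucc⇔CycStep i j)

module _ {k : ℕ} where

  halve : Fin (2 * k) → Fin k × Fin 2
  halve = remQuot 2 ∘ cast (*-comm 2 k)

  parity : Fin (2 * k) → Fin 2
  parity = proj₂ ∘ halve

  toℕ-halve : (e : Fin (2 * k)) → toℕ e ≡ 2 * toℕ (proj₁ (halve e)) + toℕ (parity e)
  toℕ-halve e = begin
    toℕ e                            ≡⟨ toℕ-cast (*-comm 2 k) e ⟨
    toℕ (cast (*-comm 2 k) e)        ≡⟨ cong toℕ (combine-remQuot {k} 2 (cast (*-comm 2 k) e)) ⟨
    toℕ (uncurry combine (halve e))  ≡⟨ toℕ-combine (proj₁ (halve e)) (parity e) ⟩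
    2 * toℕ (proj₁ (halve e)) + toℕ (parity e) ∎
    where open ≡-Reasoning

  halve-injective : Injective _≡_ _≡_ halve
  halve-injective {x = e} {e′} eq = toℕ-injective (begin
    toℕ e                                        ≡⟨ toℕ-halve e ⟩
    2 * toℕ (proj₁ (halve e)) + toℕ (parity e)   ≡⟨ cong (λ (q , t) → 2 * toℕ q + toℕ t) eq ⟩
    2 * toℕ (proj₁ (halve e′)) + toℕ (parity e′) ≡⟨ toℕ-halve e′ ⟨
    toℕ e′ ∎)
    where open ≡-Reasoning

parity-alternates : ∀ {k} → CyclicallyAlternating (parity {suc k})
parity-alternates {k} = consecutive , wrap
  where
  open ≡-Reasoning
  P = parity {suc k}
  H = halve {suc k}
  consecutive : ∀ e → P (inject₁ e) ≢ P (suc e)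
  consecutive e same = even≢odd q′ q (+-cancelʳ-≡ (toℕ t) _ _ (begin
    2 * q′ + toℕ t                   ≡⟨ cong (λ t → 2 * q′ + toℕ t) same ⟩
    2 * q′ + toℕ (P (suc e))         ≡⟨ toℕ-halve {suc k} (suc e) ⟨
    suc (toℕ e)                      ≡⟨ cong suc (toℕ-inject₁ e) ⟨
    suc (toℕ (inject₁ e))            ≡⟨ cong suc (toℕ-halve {suc k} (inject₁ e)) ⟩
    suc (2 * q + toℕ t)              ∎))
    where
    q  = toℕ (proj₁ (H (inject₁ e)))
    q′ = toℕ (proj₁ (H (suc e)))
    t  = P (inject₁ e)
  wrap : P (fromℕ _) ≢ P zero
  wrap same = even≢odd q k (begin
    2 * q                            ≡⟨ +-identityʳ (2 * q) ⟨
    2 * q + 0                        ≡⟨ cong (2 * q +_) parity-zero ⟨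
    2 * q + toℕ (P zero)             ≡⟨ cong (λ t → 2 * q + toℕ t) same ⟨
    2 * q + toℕ (P (fromℕ _))        ≡⟨ toℕ-halve {suc k} (fromℕ _) ⟨
    toℕ (fromℕ (k + suc (k + 0)))    ≡⟨ toℕ-fromℕ _ ⟩
    k + suc (k + 0)                  ≡⟨ +-suc k (k + 0) ⟩
    suc (2 * k)                      ∎)
    where
    q = toℕ (proj₁ (H (fromℕ _)))
    parity-zero = m+n≡0⇒n≡0 _ (sym (toℕ-halve {suc k} zero))

module _ {k} (X Y : Fin k → A) where

  choose : Fin k × Fin 2 → A
  choose (i , zero)  = X i
  choose (i , suc _) = Y i

  interleave : Fin (2 * k) → A
  interleave = choose ∘ halve

  interleave-injective : Injective _≡_ _≡_ X → Injective _≡_ _≡_ Y → (∀ i j → X i ≢ Y j) →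
    Injective _≡_ _≡_ interleave
  interleave-injective X-inj Y-inj X≢Y = halve-injective ∘ choose-injective
    where
    choose-injective : Injective _≡_ _≡_ choose
    choose-injective {i , zero}     {j , zero}     eq = cong (_, zero) (X-inj eq)
    choose-injective {i , zero}     {j , suc zero} eq = ⊥-elim (X≢Y i j eq)
    choose-injective {i , suc zero} {j , zero}     eq = ⊥-elim (X≢Y j i (sym eq))
    choose-injective {i , suc zero} {j , suc zero} eq = cong (_, suc zero) (Y-inj eq)

  module _ (f : A → B) (separated : ∀ i j → f (X i) ≢ f (Y j)) where

    choose-separates : ∀ a a′ → proj₂ a ≢ proj₂ a′ → f (choose a) ≢ f (choose a′)
    choose-separates (i , zero)     (j , zero)     ne = ⊥-elim (ne refl)
    choose-separates (i , zero)     (j , suc zero) _  = separated i j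
    choose-separates (i , suc zero) (j , zero)     _  = separated j i ∘ sym
    choose-separates (i , suc zero) (j , suc zero) ne = ⊥-elim (ne refl)

interleave-alternates : ∀ {k} (X Y : Fin (suc k) → A) (f : A → B) → (∀ i j → f (X i) ≢ f (Y j)) →
  CyclicallyAlternating (f ∘ interleave X Y)
interleave-alternates {k = k} X Y f separated =
  (λ e → choose-separates X Y f separated _ _ (proj₁ (parity-alternates {k}) e)) ,
  choose-separates X Y f separated _ _ (proj₂ (parity-alternates {k}))

interleave-∀ : ∀ {p k} {P : A → Set p} {X Y : Fin k → A} →
  (∀ i → P (X i)) → (∀ i → P (Y i)) → ∀ e → P (interleave X Y e)
interleave-∀ {P = P} {X} {Y} PX PY = choose-∀ ∘ halve
  where
  choose-∀ : ∀ a → P (choose X Y a)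
  choose-∀ (i , zero)  = PX i
  choose-∀ (i , suc _) = PY i

between-stable : ∀ {M j l c d} → l ≤ M → CycAdj M c d → j < c → c < l → d ≢ j → d ≢ l →
  j < d × d < l
between-stable _   (inj₁ (inj₁ refl))          j<c c<l _   d≢l = m<n⇒m<1+n j<c , ≤∧≢⇒< c<l d≢l
between-stable l≤M (inj₁ (inj₂ (refl , refl))) _   c<l _   _   = ⊥-elim (<⇒≱ c<l l≤M)
between-stable _   (inj₂ (inj₁ refl))          j<c c<l d≢j _   =
  ≤∧≢⇒< (≤-pred j<c) (≢-sym d≢j) , <-trans (n<1+n _) c<l
between-stable _   (inj₂ (inj₂ (refl , refl))) ()  _   _   _

module _ {n} {G : Graph n} {M} (F : BraceletLabelling G M) where

  module Separation {j l} (j<l : j < l) (l≤M : l ≤ M) where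

    Separator : Fin n → Set
    Separator w = label F w ≡ j ⊎ label F w ≡ l

    separator? : Decidable Separator
    separator? = (λ w → label F w ≟ j) ∪? (λ w → label F w ≟ l)

    count-separator : count separator? ≡ size F j + size F l
    count-separator = count-∪ (λ w → label F w ≟ j) (λ w → label F w ≟ l)
      (λ w↦j w↦l → <⇒≢ j<l (trans (sym w↦j) w↦l))

    inside? : ∀ c → Dec (j < c × c < l)
    inside? c = (j <? c) ×-dec (c <? l)

    side : Fin n → Bool
    side w = does (inside? (label F w))

    side-stable : ∀ {u w} → Adj G u w → ¬ Separator u → ¬ Separator w → side u ≡ side w
    side-stable {u} {w} adj ¬sep-u ¬sep-w = does-⇔ (mk⇔ forth back) (inside? _) (inside? _)
      where
      u~w = to (adj⇔ F u w) adj
      forth = λ (j<u , u<l) →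
        between-stable l≤M u~w j<u u<l (¬sep-w ∘ inj₁) (¬sep-w ∘ inj₂)
      back  = λ (j<w , w<l) →
        between-stable l≤M (⊎-swap u~w) j<w w<l (¬sep-u ∘ inj₁) (¬sep-u ∘ inj₂)

  separator-bound : ∀ {k j x l y} → Ordered (2 * k) G → j < x → x < l → l ≤ M → y < j ⊎ l < y →
    k ≤ size F x → k ≤ size F y → 2 * k ≤ size F j + size F l
  separator-bound {zero} _ _ _ _ _ _ _ = z≤n
  separator-bound {suc k} {j} {x} {l} {y} ordered j<x x<l l≤M y-outside k≤x k≤y = begin
    2 * suc k
      ≤⟨ alternations≤cut-size separator? side side-stable C in-order
           (interleave-∀ {P = ¬_ ∘ Separator}
              (outside-separator x≢j x≢l ∘ X↦x) (outside-separator y≢j y≢l ∘ Y↦y))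
           (interleave-alternates X Y side sides-differ) ⟩
    count separator?
      ≡⟨ count-separator ⟩
    size F j + size F l ∎
    where
    open ≤-Reasoning
    open Separation (<-trans j<x x<l) l≤M
    outside-separator : ∀ {c w} → c ≢ j → c ≢ l → label F w ≡ c → ¬ Separator w
    outside-separator c≢j c≢l refl = [ c≢j , c≢l ]′
    x≢j = ≢-sym (<⇒≢ j<x)
    x≢l = <⇒≢ x<l
    y≢j : y ≢ j
    y≢j = [ <⇒≢ , (λ l<y → ≢-sym (<⇒≢ (<-trans (<-trans j<x x<l) l<y))) ]′ y-outside
    y≢l : y ≢ l
    y≢l = [ (λ y<j → <⇒≢ (<-trans y<j (<-trans j<x x<l))) , ≢-sym ∘ <⇒≢ ]′ y-outside
    y-not-inside : ¬ (j < y × y < l)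
    y-not-inside (j<y , y<l) = [ <-asym j<y , <-asym y<l ]′ y-outside
    X-selection = select (λ w → label F w ≟ x) k≤x
    Y-selection = select (λ w → label F w ≟ y) k≤y
    X = proj₁ X-selection
    X-injective = proj₁ (proj₂ X-selection)
    X↦x = proj₂ (proj₂ X-selection)
    Y = proj₁ Y-selection
    Y-injective = proj₁ (proj₂ Y-selection)
    Y↦y = proj₂ (proj₂ Y-selection)
    side-X : ∀ i → side (X i) ≡ true
    side-X i rewrite X↦x i = dec-true (inside? x) (j<x , x<l)
    side-Y : ∀ i → side (Y i) ≡ false
    side-Y i rewrite Y↦y i = dec-false (inside? y) y-not-inside
    sides-differ : ∀ i i′ → side (X i) ≢ side (Y i′)
    sides-differ i i′ eq with () ← trans (sym (side-X i)) (trans eq (side-Y i′))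
    cycle = ordered (interleave X Y) (interleave-injective X Y X-injective Y-injective
                                        (λ i i′ → sides-differ i i′ ∘ cong side))
    C = proj₁ cycle
    in-order = proj₂ cycle

-- Sizes of the parts

private
  double : ∀ k → k + k ≡ 2 * k
  double = solve-∀

  double+2 : ∀ k → suc k + suc k ≡ 2 * k + 2
  double+2 = solve-∀

sum<double : ∀ {k m n} → m < k → n ≤ k → m + n < 2 * k
sum<double {k} {m} {n} m<k n≤k = subst (m + n <_) (double k) (+-mono-<-≤ m<k n≤k)

complement-≥ : ∀ {k m n} → 2 * k ∸ 1 ≤ m + n → m < k → k ≤ n
complement-≥ {k} {m} {n} lower m<k = ≮⇒≥ λ n<k →
  <⇒≱ (subst (_≤ 2 * k) (+-suc (suc m) n) (subst (suc m + suc n ≤_) (double k) (+-mono-≤ m<k n<k)))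
      (≤-trans (m≤n+m∸n (2 * k) 1) (s≤s lower))

complement-≤ : ∀ {k m n} → m + n < 2 * k + 2 → k < m → n ≤ k
complement-≤ {k} {m} {n} upper k<m = ≮⇒≥ λ k<n →
  <⇒≱ upper (subst (_≤ m + n) (double+2 k) (+-mono-≤ k<m k<n))

complement-< : ∀ {k m n} → m + n < 2 * k → k ≤ m → n < k
complement-< {k} {m} {n} sum< k≤m = ≰⇒> λ k≤n →
  <⇒≱ sum< (subst (_≤ m + n) (double k) (+-mono-≤ k≤m k≤n))

module _ (k : ℕ) (a : ℕ → ℕ)
  (separated : ∀ {j x l y} → j < x → x < l → l ≤ 6 → y < j ⊎ l < y → k ≤ a x → k ≤ a y →
               2 * k ≤ a j + a l)
  (lower : ∀ c → 2 + c ≤ 6 → 2 * k ∸ 1 ≤ a c + a (2 + c))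
  (upper : ∀ c → 2 + c ≤ 6 → a c + a (2 + c) < 2 * k + 2) where

  module _ (a₁+a₃<2k : a 1 + a 3 < 2 * k) (a₁<k : a 1 < k) where

    thick-part-2 : k ≤ a 2 → ⊥
    thick-part-2 k≤a₂ with k ≤? a 4
    ... | yes k≤a₄ = <⇒≱ a₁+a₃<2k
      (separated (<ᵇ⇒< 1 2 _) (<ᵇ⇒< 2 3 _) (≤ᵇ⇒≤ 3 6 _) (inj₂ (<ᵇ⇒< 3 4 _)) k≤a₂ k≤a₄)
    ... | no  k≰a₄ = <⇒≱ a₁+a₃<2k
      (separated (<ᵇ⇒< 1 2 _) (<ᵇ⇒< 2 3 _) (≤ᵇ⇒≤ 3 6 _) (inj₂ (<ᵇ⇒< 3 6 _)) k≤a₂ k≤a₆)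
      where k≤a₆ = complement-≥ (lower 4 ≤-refl) (≰⇒> k≰a₄)

    module _ (a₂<k : a 2 < k) where

      private
        k≤a₀ = complement-≥ (subst (2 * k ∸ 1 ≤_) (+-comm (a 0) (a 2)) (lower 0 (≤ᵇ⇒≤ 2 6 _)))
                            a₂<k
        k≤a₃ = complement-≥ (lower 1 (≤ᵇ⇒≤ 3 6 _)) a₁<k
        k≤a₄ = complement-≥ (lower 2 (≤ᵇ⇒≤ 4 6 _)) a₂<k

      thin-part-2 : ⊥
      thin-part-2 with a 4 ≤? k
      ... | yes a₄≤k = <⇒≱ (sum<double a₁<k a₄≤k)
        (separated (<ᵇ⇒< 1 3 _) (<ᵇ⇒< 3 4 _) (≤ᵇ⇒≤ 4 6 _) (inj₁ (<ᵇ⇒< 0 1 _)) k≤a₃ k≤a₀)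
      ... | no  a₄≰k = <⇒≱ (sum<double a₂<k a₆≤k)
        (separated (<ᵇ⇒< 2 4 _) (<ᵇ⇒< 4 6 _) ≤-refl (inj₁ (<ᵇ⇒< 0 2 _)) k≤a₄ k≤a₀)
        where a₆≤k = complement-≤ (upper 4 ≤-refl) (≰⇒> a₄≰k)

    no-admissible-sizes : ⊥
    no-admissible-sizes with k ≤? a 2
    ... | yes k≤a₂ = thick-part-2 k≤a₂
    ... | no  k≰a₂ = thin-part-2 (≰⇒> k≰a₂)

module _ {n} {G : Graph n} {k M : ℕ} (ordered : Ordered (2 * k) G)
  (min-degree : ∀ w → 2 * k ∸ 1 ≤ degree G w) (max-degree : ∀ w → degree G w < 2 * k + 2) where

  module _ (F : BraceletLabelling G (6 + M)) where

    private
      degree-at : ∀ c → 2 + c ≤ 6 → ∃[ w ] degree G w ≡ size F c + size F (2 + c)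
      degree-at c c+2≤6 =
        let c+2≤M = ≤-trans c+2≤6 (m≤m+n 6 M)
            w , w↦c+1 = label-onto F (≤-trans (n≤1+n _) c+2≤M)
        in w , degree-by-sizes F w↦c+1 c+2≤M

    part-2-neighbours< : ∀ {v} → label F v ≡ 2 → degree G v < 2 * k → size F 1 + size F 3 < 2 * k
    part-2-neighbours< v↦2 = subst (_< 2 * k) (degree-by-sizes F v↦2 (m≤m+n 3 _))

    no-thin-part-1 : ∀ {v} → label F v ≡ 2 → degree G v < 2 * k → size F 1 < k → ⊥
    no-thin-part-1 v↦2 v-degree< =
      no-admissible-sizes k (size F)
        (λ j<x x<l l≤6 → separator-bound F ordered j<x x<l (≤-trans l≤6 (m≤m+n 6 M)))
        (λ c c+2≤6 → let w , deg-w = degree-at c c+2≤6 in subst (2 * k ∸ 1 ≤_) deg-w (min-degree w))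
        (λ c c+2≤6 → let w , deg-w = degree-at c c+2≤6 in subst (_< 2 * k + 2) deg-w (max-degree w))
        (part-2-neighbours< v↦2 v-degree<)

  no-vertex-in-part-2 : (F : BraceletLabelling G (6 + M)) → ∀ {v} → label F v ≡ 2 →
    degree G v < 2 * k → ⊥
  no-vertex-in-part-2 F v↦2 v-degree< with size F 1 <? k | reflection-fixing-2 {2 + M}
  ... | yes thin | _ = no-thin-part-1 F v↦2 v-degree< thin
  ... | no ¬thin | τ , τ2≡2 , τ3≡1 =
    no-thin-part-1 (relabel F τ) (trans (cong (act τ) v↦2) τ2≡2) v-degree<
      (subst (_< k) (sym mirrored-size)
        (complement-< (part-2-neighbours< F v↦2 v-degree<) (≮⇒≥ ¬thin)))
    where
    mirrored-size : size (relabel F τ) 1 ≡ size F 3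
    mirrored-size =
      subst (λ c → size (relabel F τ) c ≡ size F 3) τ3≡1 (size-relabel F τ (m≤m+n 3 _))

  no-low-degree-vertex : BraceletLabelling G (6 + M) → ∀ v → degree G v < 2 * k → ⊥
  no-low-degree-vertex F v v-degree< with moving-to-2 {3 + M} (label F v)
  ... | σ , σv≡2 = no-vertex-in-part-2 (relabel F σ) σv≡2 v-degree<

proposition4p3 : ∀ (k : ℕ) → 1 ≤ k → ∀ (n : ℕ) (G : Graph n) →
    ¬ ((∃[ m ] (6 < m × IsBraceletWithParts G m))
       × Ordered (2 * k) G
       × MinDegreeIs G (2 * k ∸ 1)
       × MaxDegreeLessThan G (2 * k + 2))
proposition4p3 (suc k) _ n G
  ((m , 6<m , _ , bracelet) , ordered , ((v , v-degree) , min-degree) , max-degree)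
  with m≤n⇒∃[o]m+o≡n 6<m
... | M , refl =
  no-low-degree-vertex {k = suc k} ordered min-degree max-degree (bracelet-labelling bracelet) v
    (subst (_< 2 * suc k) (sym v-degree) (n<1+n _))
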